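{- Let $r,p,n\in\mathbb N=\{1,2,3,\dots\}$. Then $$ \sum_{k=1}^{n} \binom{k}{p} H_{n-k}^{(r)}=\sum_{t=0}^{p+1}a_{6}(p,n,t)\,H_{n-1}^{(r-t)}, $$ where $$ a_{6}(p,n,t)=\frac{1}{(p+1)!}\sum_{i=t}^{p+1} s(p+1,i) \binom{i}{t} (-1)^{t} (n+1)^{i-t}. $$
   Context: For every integer $m$ (possibly zero or negative) and $N\ge0$, $H_N^{(m)}=\sum_{j=1}^N j^{ -m}$ (so $H_0^{(m)}=0$). $s(k,i)$ denotes the (signed) Stirling numbers of the first kind: $x(x-1)\cdots(x-k+1)=\sum_{i=0}^k s(k,i)x^i$. The convention $0^0=1$ is used. -}

module Defs where

open import Data.Nat as ℕ using (ℕ; zero; suc)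
open import Data.Nat.Combinatorics using (_C_)
open import Data.Nat.Properties using (m^n≢0; _!≢0)
open import Data.Bool using (true; false)
open import Data.Integer as ℤ using (ℤ; +_; -[1+_])
open import Data.Rational as ℚ using (ℚ; _/_)

-- Signed Stirling numbers of the first kind s(k,i):
-- x(x-1)...(x-k+1) = Σ_i s(k,i) x^i, via s(k+1,i) = s(k,i-1) - k s(k,i).
stirling1 : ℕ → ℕ → ℤ
stirling1 zero    zero    = + 1
stirling1 zero    (suc i) = + 0
stirling1 (suc k) zero    = ℤ.- ((+ k) ℤ.* stirling1 k zero)
stirling1 (suc k) (suc i) = stirling1 k i ℤ.- ((+ k) ℤ.* stirling1 k (suc i))

fromℤ : ℤ → ℚ
fromℤ z = z / 1

powNeg : ℕ → ℤ → ℚ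
powNeg j (+ m)     = _/_ (+ 1) (suc j ℕ.^ m) ⦃ m^n≢0 (suc j) m ⦄
powNeg j -[1+ m ]  = fromℤ (+ (suc j ℕ.^ suc m))

H : ℤ → ℕ → ℚ
H m zero    = ℚ.0ℚ
H m (suc N) = H m N ℚ.+ powNeg N m

-- Σ_{i=a}^{b} f i (empty if b < a); defined as Σ_{i=0}^{b} [i ≥ a] f i.
sumFromTo : ℕ → ℕ → (ℕ → ℚ) → ℚ
sumFromTo a zero    f with a
... | zero  = f 0
... | suc _ = ℚ.0ℚ
sumFromTo a (suc b) f with a ℕ.≤ᵇ suc b
... | true  = sumFromTo a b f ℚ.+ f (suc b)
... | false = sumFromTo a b f

negOnePow : ℕ → ℚ
negOnePow zero = ℚ.1ℚ
negOnePow (suc t) = ℚ.- negOnePow t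

a6 : ℕ → ℕ → ℕ → ℚ
a6 p n t =
  _/_ (+ 1) (ℕ._! (suc p)) ⦃ (suc p) !≢0 ⦄ ℚ.*
  sumFromTo t (suc p) (λ i →
    fromℤ (stirling1 (suc p) i) ℚ.* fromℤ (+ (i C t)) ℚ.*
    negOnePow t ℚ.* fromℤ (+ (suc n ℕ.^ (i ℕ.∸ t))))

-- Expanding H_{n-k}^{(r)} = Σ_{j<n-k} (j+1)^{-r} and exchanging the order of summation, the
-- hockey-stick identity Σ_{k<m} C(k,p) = C(m,p+1) turns the left side into
-- Σ_{j<n} (j+1)^{-r} C(n-j,p+1); the term j = n-1 vanishes since C(1,p+1) = 0.
-- Now (p+1)! C(n-j,p+1) is the falling factorial of x = (n+1) - (j+1), which the Stirling
-- numbers expand in powers of x and the binomial theorem then in powers of j+1: the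
-- coefficient of (j+1)^t is a₆(p,n,t), and (j+1)^{-r} (j+1)^t = (j+1)^{-(r-t)}.
module Submission where

open import Defs
open import Data.Nat using (ℕ; suc; _∸_; _≤_)
open import Data.Nat.Combinatorics using (_C_)
open import Data.Integer using (+_; _-_)
open import Data.Rational using (_*_)
open import Relation.Binary.PropositionalEquality using (_≡_)

open import Data.Bool.Base using (true; false; T)
open import Data.Fin.Base using (toℕ)
open import Data.Fin.Properties using (toℕ<n; opposite-prop)
open import Data.Fin.Permutation using (reverse)
open import Data.Integer.Base as ℤ using (-[1+_])
import Data.Integer.Properties as ℤ
open import Data.Nat.Base as ℕ using (zero; _<_; NonZero)
import Data.Nat.Properties as ℕ
open import Data.Nat.Combinatorics using (k>n⇒nCk≡0; nCk+nC[k+1]≡[n+1]C[k+1])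
open import Data.Rational.Base as ℚ using (ℚ; 0ℚ; 1ℚ; _+_; -_)
import Data.Rational.Properties as ℚ
open import Data.Rational.Unnormalised.Base as ℚᵘ using (mkℚᵘ; *≡*)
import Data.Rational.Unnormalised.Properties as ℚᵘ
open import Level using (0ℓ)
open import Relation.Nullary.Decidable.Core using (dec⇒maybe)
open import Relation.Binary.PropositionalEquality using (refl; sym; trans; cong; cong₂; subst; module ≡-Reasoning)
open import Tactic.RingSolver using (solve-∀)
open import Data.Integer.Tactic.RingSolver using () renaming (ring to ℤ-ring)
open import Tactic.RingSolver.Core.AlmostCommutativeRing using (AlmostCommutativeRing; fromCommutativeRing)

open import Algebra.Bundles using (CommutativeRing)
open CommutativeRing ℚ.+-*-commutativeRing using (semiring; commutativeSemiring)

open import Algebra.Properties.Semiring.Exp semiring using (_^_)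
open import Algebra.Properties.Semiring.Mult semiring using (_×_)
import Algebra.Properties.Semiring.Sum semiring as Sum
import Algebra.Properties.CommutativeSemiring.Binomial commutativeSemiring as Binomial

ℚ-ring : AlmostCommutativeRing 0ℓ 0ℓ
ℚ-ring = fromCommutativeRing ℚ.+-*-commutativeRing (λ x → dec⇒maybe (0ℚ ℚ.≟ x))

fromℤ≃mkℚᵘ : ∀ a → ℚ.toℚᵘ (fromℤ a) ℚᵘ.≃ mkℚᵘ a 0
fromℤ≃mkℚᵘ a = ℚ.toℚᵘ-fromℚᵘ (mkℚᵘ a 0)

fromℤ-+ : ∀ a b → fromℤ (a ℤ.+ b) ≡ fromℤ a + fromℤ b
fromℤ-+ a b = ℚ.toℚᵘ-injective (begin
  ℚ.toℚᵘ (fromℤ (a ℤ.+ b))               ≈⟨ fromℤ≃mkℚᵘ (a ℤ.+ b) ⟩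
  mkℚᵘ (a ℤ.+ b) 0                       ≈⟨ *≡* (cong (ℤ._* + 1) (sym (cong₂ ℤ._+_ (ℤ.*-identityʳ a) (ℤ.*-identityʳ b)))) ⟩
  mkℚᵘ a 0 ℚᵘ.+ mkℚᵘ b 0                 ≈⟨ ℚᵘ.+-cong (fromℤ≃mkℚᵘ a) (fromℤ≃mkℚᵘ b) ⟨
  ℚ.toℚᵘ (fromℤ a) ℚᵘ.+ ℚ.toℚᵘ (fromℤ b) ≈⟨ ℚ.toℚᵘ-homo-+ (fromℤ a) (fromℤ b) ⟨
  ℚ.toℚᵘ (fromℤ a + fromℤ b)             ∎)
  where open ℚᵘ.≃-Reasoning

fromℤ-* : ∀ a b → fromℤ (a ℤ.* b) ≡ fromℤ a * fromℤ b
fromℤ-* a b = ℚ.toℚᵘ-injective (begin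
  ℚ.toℚᵘ (fromℤ (a ℤ.* b))               ≈⟨ fromℤ≃mkℚᵘ (a ℤ.* b) ⟩
  mkℚᵘ (a ℤ.* b) 0                       ≈⟨ ℚᵘ.*-cong (fromℤ≃mkℚᵘ a) (fromℤ≃mkℚᵘ b) ⟨
  ℚ.toℚᵘ (fromℤ a) ℚᵘ.* ℚ.toℚᵘ (fromℤ b) ≈⟨ ℚ.toℚᵘ-homo-* (fromℤ a) (fromℤ b) ⟨
  ℚ.toℚᵘ (fromℤ a * fromℤ b)             ∎)
  where open ℚᵘ.≃-Reasoning

fromℤ-neg : ∀ a → fromℤ (ℤ.- a) ≡ - fromℤ a
fromℤ-neg a = ℚ.toℚᵘ-injective (begin
  ℚ.toℚᵘ (fromℤ (ℤ.- a))   ≈⟨ fromℤ≃mkℚᵘ (ℤ.- a) ⟩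
  mkℚᵘ (ℤ.- a) 0           ≈⟨ ℚᵘ.-‿cong (fromℤ≃mkℚᵘ a) ⟨
  ℚᵘ.- ℚ.toℚᵘ (fromℤ a)    ≈⟨ ℚ.toℚᵘ-homo‿- (fromℤ a) ⟨
  ℚ.toℚᵘ (- fromℤ a)       ∎)
  where open ℚᵘ.≃-Reasoning

fromℕ : ℕ → ℚ
fromℕ n = fromℤ (+ n)

[1/n]*n≡1 : ∀ n .{{_ : NonZero n}} → (+ 1 ℚ./ n) * fromℕ n ≡ 1ℚ
[1/n]*n≡1 (suc m) = ℚ.toℚᵘ-injective (begin
  ℚ.toℚᵘ ((+ 1 ℚ./ suc m) * fromℕ (suc m))               ≈⟨ ℚ.toℚᵘ-homo-* (+ 1 ℚ./ suc m) (fromℕ (suc m)) ⟩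
  ℚ.toℚᵘ (+ 1 ℚ./ suc m) ℚᵘ.* ℚ.toℚᵘ (fromℕ (suc m))     ≈⟨ ℚᵘ.*-cong (ℚ.toℚᵘ-fromℚᵘ (mkℚᵘ (+ 1) m)) (fromℤ≃mkℚᵘ (+ suc m)) ⟩
  mkℚᵘ (+ 1) m ℚᵘ.* mkℚᵘ (+ suc m) 0                       ≈⟨ *≡* (cong (λ k → + suc k) (trans (cong (ℕ._* 1) (ℕ.+-identityʳ m)) (sym (ℕ.+-identityʳ (m ℕ.* 1))))) ⟩
  ℚᵘ.1ℚᵘ                                                   ∎)
  where open ℚᵘ.≃-Reasoning

open ≡-Reasoning

fromℕ-+ : ∀ m n → fromℕ (m ℕ.+ n) ≡ fromℕ m + fromℕ n
fromℕ-+ m n = trans (cong fromℤ (ℤ.pos-+ m n)) (fromℤ-+ (+ m) (+ n))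

fromℕ-* : ∀ m n → fromℕ (m ℕ.* n) ≡ fromℕ m * fromℕ n
fromℕ-* m n = trans (cong fromℤ (ℤ.pos-* m n)) (fromℤ-* (+ m) (+ n))

fromℕ-^ : ∀ m t → fromℕ (m ℕ.^ t) ≡ fromℕ m ^ t
fromℕ-^ m zero    = refl
fromℕ-^ m (suc t) = trans (fromℕ-* m (m ℕ.^ t)) (cong (fromℕ m *_) (fromℕ-^ m t))

fromℕ-∸ : ∀ {m n} → n ≤ m → fromℕ (m ∸ n) ≡ fromℕ m ℚ.- fromℕ n
fromℕ-∸ {m} {n} n≤m = begin
  fromℕ (m ∸ n)                           ≡⟨ +-∸-cancel (fromℕ (m ∸ n)) (fromℕ n) ⟩
  (fromℕ (m ∸ n) + fromℕ n) ℚ.- fromℕ n    ≡⟨ cong (ℚ._- fromℕ n) (sym (fromℕ-+ (m ∸ n) n)) ⟩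
  fromℕ (m ∸ n ℕ.+ n) ℚ.- fromℕ n          ≡⟨ cong (λ k → fromℕ k ℚ.- fromℕ n) (ℕ.m∸n+n≡m n≤m) ⟩
  fromℕ m ℚ.- fromℕ n                      ∎
  where
  +-∸-cancel : ∀ x y → x ≡ (x + y) ℚ.- y
  +-∸-cancel = solve-∀ ℚ-ring

×≡fromℕ* : ∀ m x → m × x ≡ fromℕ m * x
×≡fromℕ* zero    x = sym (ℚ.*-zeroˡ x)
×≡fromℕ* (suc m) x = begin
  x + m × x              ≡⟨ cong (_+_ x) (×≡fromℕ* m x) ⟩
  x + fromℕ m * x        ≡⟨ x+yx≡[1+y]x x (fromℕ m) ⟩
  (1ℚ + fromℕ m) * x     ≡⟨ cong (_* x) (fromℕ-+ 1 m) ⟨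
  fromℕ (suc m) * x      ∎
  where
  x+yx≡[1+y]x : ∀ x y → x + y * x ≡ (1ℚ + y) * x
  x+yx≡[1+y]x = solve-∀ ℚ-ring

*-inverse-unique : ∀ {x y u} → x * u ≡ 1ℚ → y * u ≡ 1ℚ → x ≡ y
*-inverse-unique {x} {y} {u} xu≡1 yu≡1 = begin
  x              ≡⟨ ℚ.*-identityʳ x ⟨
  x * 1ℚ         ≡⟨ cong (x *_) yu≡1 ⟨
  x * (y * u)    ≡⟨ x[yu]≡y[xu] x y u ⟩
  y * (x * u)    ≡⟨ cong (y *_) xu≡1 ⟩
  y * 1ℚ         ≡⟨ ℚ.*-identityʳ y ⟩
  y              ∎
  where
  x[yu]≡y[xu] : ∀ x y u → x * (y * u) ≡ y * (x * u)
  x[yu]≡y[xu] = solve-∀ ℚ-ring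

powNeg-pred : ∀ j m → powNeg j (m - + 1) ≡ powNeg j m * fromℕ (suc j)
powNeg-pred j (+ zero)  = trans (cong fromℕ (ℕ.*-identityʳ (suc j))) (sym (ℚ.*-identityˡ (fromℕ (suc j))))
powNeg-pred j (+ suc k) = *-inverse-unique {u = fromℕ (suc j ℕ.^ k)}
  ([1/n]*n≡1 (suc j ℕ.^ k) {{ℕ.m^n≢0 (suc j) k}})
  (begin
    (1/j^[k+1] * fromℕ (suc j)) * fromℕ (suc j ℕ.^ k)   ≡⟨ ℚ.*-assoc 1/j^[k+1] (fromℕ (suc j)) (fromℕ (suc j ℕ.^ k)) ⟩
    1/j^[k+1] * (fromℕ (suc j) * fromℕ (suc j ℕ.^ k))   ≡⟨ cong (1/j^[k+1] *_) (fromℕ-* (suc j) (suc j ℕ.^ k)) ⟨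
    1/j^[k+1] * fromℕ (suc j ℕ.^ suc k)                 ≡⟨ [1/n]*n≡1 (suc j ℕ.^ suc k) {{ℕ.m^n≢0 (suc j) (suc k)}} ⟩
    1ℚ                                                  ∎)
  where
  1/j^[k+1] : ℚ
  1/j^[k+1] = (+ 1 ℚ./ (suc j ℕ.^ suc k)) {{ℕ.m^n≢0 (suc j) (suc k)}}
powNeg-pred j -[1+ k ]  = begin
  fromℕ (suc j ℕ.^ suc (suc (k ℕ.+ 0)))          ≡⟨ cong (λ i → fromℕ (suc j ℕ.^ suc (suc i))) (ℕ.+-identityʳ k) ⟩
  fromℕ (suc j ℕ.* suc j ℕ.^ suc k)              ≡⟨ fromℕ-* (suc j) (suc j ℕ.^ suc k) ⟩
  fromℕ (suc j) * fromℕ (suc j ℕ.^ suc k)        ≡⟨ ℚ.*-comm (fromℕ (suc j)) (fromℕ (suc j ℕ.^ suc k)) ⟩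
  fromℕ (suc j ℕ.^ suc k) * fromℕ (suc j)        ∎

powNeg-∸ : ∀ j m t → powNeg j (m - + t) ≡ powNeg j m * fromℕ (suc j) ^ t
powNeg-∸ j m zero    = trans (cong (powNeg j) (ℤ.+-identityʳ m)) (sym (ℚ.*-identityʳ (powNeg j m)))
powNeg-∸ j m (suc t) = begin
  powNeg j (m - + suc t)                     ≡⟨ cong (powNeg j) (m-[1+t]≡[m-t]-1 m (+ t)) ⟩
  powNeg j ((m - + t) - + 1)                 ≡⟨ powNeg-pred j (m - + t) ⟩
  powNeg j (m - + t) * B                     ≡⟨ cong (_* B) (powNeg-∸ j m t) ⟩
  powNeg j m * B ^ t * B                     ≡⟨ xy*z≡x*zy (powNeg j m) (B ^ t) B ⟩
  powNeg j m * B ^ suc t                     ∎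
  where
  B = fromℕ (suc j)
  m-[1+t]≡[m-t]-1 : ∀ m t → m - (+ 1 ℤ.+ t) ≡ (m - t) - + 1
  m-[1+t]≡[m-t]-1 = solve-∀ ℤ-ring
  xy*z≡x*zy : ∀ x y z → x * y * z ≡ x * (z * y)
  xy*z≡x*zy = solve-∀ ℚ-ring

∑ : ℕ → (ℕ → ℚ) → ℚ
∑ n f = Sum.sum {n} (λ i → f (toℕ i))

syntax ∑ n (λ i → e) = ∑[ i < n ] e

∑-cong< : ∀ n {f g : ℕ → ℚ} → (∀ i → i < n → f i ≡ g i) → ∑ n f ≡ ∑ n g
∑-cong< n f≡g = Sum.sum-cong-≗ {n} (λ i → f≡g (toℕ i) (toℕ<n i))

∑-cong : ∀ n {f g : ℕ → ℚ} → (∀ i → f i ≡ g i) → ∑ n f ≡ ∑ n g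
∑-cong n f≡g = ∑-cong< n (λ i _ → f≡g i)

∑-suc : ∀ n (f : ℕ → ℚ) → ∑ (suc n) f ≡ ∑ n f + f n
∑-suc zero    f = trans (ℚ.+-identityʳ (f 0)) (sym (ℚ.+-identityˡ (f 0)))
∑-suc (suc n) f = begin
  f 0 + ∑[ i < suc n ] f (suc i)             ≡⟨ cong (_+_ (f 0)) (∑-suc n (λ i → f (suc i))) ⟩
  f 0 + (∑[ i < n ] f (suc i) + f (suc n))   ≡⟨ ℚ.+-assoc (f 0) (∑[ i < n ] f (suc i)) (f (suc n)) ⟨
  ∑ (suc n) f + f (suc n)                    ∎

∑-distrib-+ : ∀ n (f g : ℕ → ℚ) → ∑[ i < n ] (f i + g i) ≡ ∑ n f + ∑ n g
∑-distrib-+ n f g = Sum.∑-distrib-+ {n} (λ i → f (toℕ i)) (λ i → g (toℕ i))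

*-distribˡ-∑ : ∀ n x (f : ℕ → ℚ) → x * ∑ n f ≡ ∑[ i < n ] (x * f i)
*-distribˡ-∑ n x f = Sum.*-distribˡ-sum {n} x (λ i → f (toℕ i))

*-distribʳ-∑ : ∀ n x (f : ℕ → ℚ) → ∑ n f * x ≡ ∑[ i < n ] (f i * x)
*-distribʳ-∑ n x f = Sum.*-distribʳ-sum {n} x (λ i → f (toℕ i))

∑-comm : ∀ m n (f : ℕ → ℕ → ℚ) → ∑[ i < m ] ∑[ j < n ] f i j ≡ ∑[ j < n ] ∑[ i < m ] f i j
∑-comm m n f = Sum.∑-comm {m} {n} (λ i j → f (toℕ i) (toℕ j))

∑-reverse : ∀ n (f : ℕ → ℚ) → ∑ n f ≡ ∑[ i < n ] f (n ∸ suc i)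
∑-reverse n f = trans (Sum.sum-permute {n} (λ i → f (toℕ i)) reverse)
                      (Sum.sum-cong-≗ {n} (λ i → cong f (opposite-prop {n} i)))

∑-extend : ∀ {k m} (f : ℕ → ℚ) → (∀ i → k ≤ i → f i ≡ 0ℚ) → k ≤ m → ∑ m f ≡ ∑ k f
∑-extend {k} {m} f f≡0 k≤m = trans (cong (λ n → ∑ n f) (sym (ℕ.m+[n∸m]≡n k≤m))) (extend (m ∸ k))
  where
  extend : ∀ d → ∑ (k ℕ.+ d) f ≡ ∑ k f
  extend zero    = cong (λ n → ∑ n f) (ℕ.+-identityʳ k)
  extend (suc d) = begin
    ∑ (k ℕ.+ suc d) f           ≡⟨ cong (λ n → ∑ n f) (ℕ.+-suc k d) ⟩
    ∑ (suc (k ℕ.+ d)) f         ≡⟨ ∑-suc (k ℕ.+ d) f ⟩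
    ∑ (k ℕ.+ d) f + f (k ℕ.+ d) ≡⟨ cong₂ _+_ (extend d) (f≡0 (k ℕ.+ d) (ℕ.m≤m+n k d)) ⟩
    ∑ k f + 0ℚ                  ≡⟨ ℚ.+-identityʳ (∑ k f) ⟩
    ∑ k f                       ∎

∑-*-∑-swap : ∀ m n (u v : ℕ → ℚ) (f : ℕ → ℕ → ℚ) →
  ∑[ j < m ] (u j * ∑[ t < n ] (v t * f j t)) ≡ ∑[ t < n ] (v t * ∑[ j < m ] (u j * f j t))
∑-*-∑-swap m n u v f = begin
  ∑[ j < m ] (u j * ∑[ t < n ] (v t * f j t))   ≡⟨ ∑-cong m (λ j → *-distribˡ-∑ n (u j) (λ t → v t * f j t)) ⟩
  ∑[ j < m ] ∑[ t < n ] (u j * (v t * f j t))   ≡⟨ ∑-cong m (λ j → ∑-cong n (λ t → x[yz]≡y[xz] (u j) (v t) (f j t))) ⟩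
  ∑[ j < m ] ∑[ t < n ] (v t * (u j * f j t))   ≡⟨ ∑-comm m n (λ j t → v t * (u j * f j t)) ⟩
  ∑[ t < n ] ∑[ j < m ] (v t * (u j * f j t))   ≡⟨ ∑-cong n (λ t → *-distribˡ-∑ m (v t) (λ j → u j * f j t)) ⟨
  ∑[ t < n ] (v t * ∑[ j < m ] (u j * f j t))   ∎
  where
  x[yz]≡y[xz] : ∀ x y z → x * (y * z) ≡ y * (x * z)
  x[yz]≡y[xz] = solve-∀ ℚ-ring

sumFromTo≡∑ : ∀ a b (f : ℕ → ℚ) → (∀ i → i < a → f i ≡ 0ℚ) → sumFromTo a b f ≡ ∑ (suc b) f
sumFromTo≡∑ zero    zero    f f≡0 = sym (ℚ.+-identityʳ (f 0))
sumFromTo≡∑ (suc a) zero    f f≡0 = trans (sym (f≡0 0 (ℕ.s≤s ℕ.z≤n))) (sym (ℚ.+-identityʳ (f 0)))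
sumFromTo≡∑ a       (suc b) f f≡0 with a ℕ.≤ᵇ suc b in a≤ᵇ1+b
... | true  = trans (cong (_+ f (suc b)) (sumFromTo≡∑ a b f f≡0)) (sym (∑-suc (suc b) f))
... | false = begin
  sumFromTo a b f             ≡⟨ sumFromTo≡∑ a b f f≡0 ⟩
  ∑ (suc b) f                 ≡⟨ ℚ.+-identityʳ (∑ (suc b) f) ⟨
  ∑ (suc b) f + 0ℚ            ≡⟨ cong (_+_ (∑ (suc b) f)) (f≡0 (suc b) 1+b<a) ⟨
  ∑ (suc b) f + f (suc b)     ≡⟨ ∑-suc (suc b) f ⟨
  ∑ (suc (suc b)) f           ∎
  where
  1+b<a : suc b < a
  1+b<a = ℕ.≰⇒> (λ a≤1+b → subst T a≤ᵇ1+b (ℕ.≤⇒≤ᵇ a≤1+b))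

H≡∑ : ∀ m N → H m N ≡ ∑[ j < N ] powNeg j m
H≡∑ m zero    = refl
H≡∑ m (suc N) = trans (cong (_+ powNeg N m) (H≡∑ m N)) (sym (∑-suc N (λ j → powNeg j m)))

fromℕ-pascal : ∀ n k → fromℕ (suc n C suc k) ≡ fromℕ (n C k) + fromℕ (n C suc k)
fromℕ-pascal n k = trans (cong fromℕ (sym (nCk+nC[k+1]≡[n+1]C[k+1] n k))) (fromℕ-+ (n C k) (n C suc k))

∑-C : ∀ m p → ∑[ k < m ] fromℕ (k C p) ≡ fromℕ (m C suc p)
∑-C zero    p = refl
∑-C (suc m) p = begin
  ∑[ k < suc m ] fromℕ (k C p)              ≡⟨ ∑-suc m (λ k → fromℕ (k C p)) ⟩
  ∑[ k < m ] fromℕ (k C p) + fromℕ (m C p)   ≡⟨ cong (_+ fromℕ (m C p)) (∑-C m p) ⟩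
  fromℕ (m C suc p) + fromℕ (m C p)          ≡⟨ ℚ.+-comm (fromℕ (m C suc p)) (fromℕ (m C p)) ⟩
  fromℕ (m C p) + fromℕ (m C suc p)          ≡⟨ fromℕ-pascal m p ⟨
  fromℕ (suc m C suc p)                      ∎

∑-*-∑-suc : ∀ n (c w : ℕ → ℚ) →
  ∑[ k < suc n ] (c k * ∑ (suc n ∸ k) w) ≡ ∑[ k < suc n ] (c k * ∑ (n ∸ k) w) + ∑[ k < suc n ] (c k * w (n ∸ k))
∑-*-∑-suc n c w = trans (∑-cong< (suc n) split) (∑-distrib-+ (suc n) (λ k → c k * ∑ (n ∸ k) w) (λ k → c k * w (n ∸ k)))
  where
  split : ∀ k → k < suc n → c k * ∑ (suc n ∸ k) w ≡ c k * ∑ (n ∸ k) w + c k * w (n ∸ k)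
  split k k<1+n = begin
    c k * ∑ (suc n ∸ k) w             ≡⟨ cong (λ m → c k * ∑ m w) (ℕ.+-∸-assoc 1 (ℕ.≤-pred k<1+n)) ⟩
    c k * ∑ (suc (n ∸ k)) w           ≡⟨ cong (c k *_) (∑-suc (n ∸ k) w) ⟩
    c k * (∑ (n ∸ k) w + w (n ∸ k))    ≡⟨ ℚ.*-distribˡ-+ (c k) (∑ (n ∸ k) w) (w (n ∸ k)) ⟩
    c k * ∑ (n ∸ k) w + c k * w (n ∸ k) ∎

∑-antidiagonal-comm : ∀ n (a w : ℕ → ℚ) → ∑[ k < suc n ] (a k * w (n ∸ k)) ≡ ∑[ j < suc n ] (w j * a (n ∸ j))
∑-antidiagonal-comm n a w = trans (∑-reverse (suc n) (λ k → a k * w (n ∸ k))) (∑-cong< (suc n) swap)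
  where
  swap : ∀ j → j < suc n → a (n ∸ j) * w (n ∸ (n ∸ j)) ≡ w j * a (n ∸ j)
  swap j j<1+n = trans (cong (λ i → a (n ∸ j) * w i) (ℕ.m∸[m∸n]≡n (ℕ.≤-pred j<1+n))) (ℚ.*-comm (a (n ∸ j)) (w j))

-- Both sides are the sum of a k * w j over all k, j with k + j < n.
∑-convolution : ∀ n (a w : ℕ → ℚ) → ∑[ k < suc n ] (a k * ∑ (n ∸ k) w) ≡ ∑[ j < n ] (w j * ∑ (n ∸ j) a)
∑-convolution zero    a w = trans (ℚ.+-identityʳ (a 0 * 0ℚ)) (ℚ.*-zeroʳ (a 0))
∑-convolution (suc n) a w = begin
  ∑[ k < suc (suc n) ] (a k * ∑ (suc n ∸ k) w)
    ≡⟨ ∑-suc (suc n) (λ k → a k * ∑ (suc n ∸ k) w) ⟩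
  ∑[ k < suc n ] (a k * ∑ (suc n ∸ k) w) + a (suc n) * ∑ (n ∸ n) w
    ≡⟨ cong₂ _+_ (∑-*-∑-suc n a w) (vanish (a (suc n)) w) ⟩
  (∑[ k < suc n ] (a k * ∑ (n ∸ k) w) + X) + 0ℚ    ≡⟨ cong (λ x → (x + X) + 0ℚ) (∑-convolution n a w) ⟩
  (R + X) + 0ℚ                                      ≡⟨ cong (λ x → (R + x) + 0ℚ) (∑-antidiagonal-comm n a w) ⟩
  (R + Y) + 0ℚ                                      ≡⟨ x+y+0≡x+0+y R Y ⟩
  (R + 0ℚ) + Y                                      ≡⟨ cong (λ x → (R + x) + Y) (vanish (w n) a) ⟨
  (R + w n * ∑ (n ∸ n) a) + Y                       ≡⟨ cong (_+ Y) (∑-suc n (λ j → w j * ∑ (n ∸ j) a)) ⟨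
  ∑[ j < suc n ] (w j * ∑ (n ∸ j) a) + Y            ≡⟨ ∑-*-∑-suc n w a ⟨
  ∑[ j < suc n ] (w j * ∑ (suc n ∸ j) a)            ∎
  where
  R = ∑[ j < n ] (w j * ∑ (n ∸ j) a)
  X = ∑[ k < suc n ] (a k * w (n ∸ k))
  Y = ∑[ j < suc n ] (w j * a (n ∸ j))
  vanish : ∀ x (v : ℕ → ℚ) → x * ∑ (n ∸ n) v ≡ 0ℚ
  vanish x v = trans (cong (λ m → x * ∑ m v) (ℕ.n∸n≡0 n)) (ℚ.*-zeroʳ x)
  x+y+0≡x+0+y : ∀ x y → (x + y) + 0ℚ ≡ (x + 0ℚ) + y
  x+y+0≡x+0+y = solve-∀ ℚ-ring

∑-C-*-∑ : ∀ n p (w : ℕ → ℚ) →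
  ∑[ k < suc n ] (fromℕ (k C p) * ∑ (n ∸ k) w) ≡ ∑[ j < n ] (w j * fromℕ ((n ∸ j) C suc p))
∑-C-*-∑ n p w = trans (∑-convolution n (λ k → fromℕ (k C p)) w) (∑-cong n (λ j → cong (w j *_) (∑-C (n ∸ j) p)))

fallingFactorial : ℕ → ℚ → ℚ
fallingFactorial zero    x = 1ℚ
fallingFactorial (suc k) x = fallingFactorial k x * (x ℚ.- fromℕ k)

fallingFactorial-suc-shift : ∀ k x → fallingFactorial (suc k) (x + 1ℚ) ≡ (x + 1ℚ) * fallingFactorial k x
fallingFactorial-suc-shift zero    x = x-0≡x*1 (x + 1ℚ)
  where
  x-0≡x*1 : ∀ x → 1ℚ * (x ℚ.- 0ℚ) ≡ x * 1ℚ
  x-0≡x*1 = solve-∀ ℚ-ring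
fallingFactorial-suc-shift (suc k) x = begin
  fallingFactorial (suc k) (x + 1ℚ) * ((x + 1ℚ) ℚ.- fromℕ (suc k))
    ≡⟨ cong₂ _*_ (fallingFactorial-suc-shift k x) (cong (ℚ._-_ (x + 1ℚ)) (fromℕ-+ 1 k)) ⟩
  (x + 1ℚ) * fallingFactorial k x * ((x + 1ℚ) ℚ.- (1ℚ + fromℕ k))
    ≡⟨ shift (x + 1ℚ) x (fallingFactorial k x) (fromℕ k) ⟩
  (x + 1ℚ) * (fallingFactorial k x * (x ℚ.- fromℕ k)) ∎
  where
  shift : ∀ y x f k → y * f * ((x + 1ℚ) ℚ.- (1ℚ + k)) ≡ y * (f * (x ℚ.- k))
  shift = solve-∀ ℚ-ring

fallingFactorial-zero : ∀ k → fallingFactorial (suc k) 0ℚ ≡ 0ℚ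
fallingFactorial-zero zero    = refl
fallingFactorial-zero (suc k) =
  trans (cong (_* (0ℚ ℚ.- fromℕ (suc k))) (fallingFactorial-zero k)) (ℚ.*-zeroˡ (0ℚ ℚ.- fromℕ (suc k)))

k!*C≡fallingFactorial : ∀ x k → fromℕ (k ℕ.!) * fromℕ (x C k) ≡ fallingFactorial k (fromℕ x)
k!*C≡fallingFactorial zero    zero    = refl
k!*C≡fallingFactorial zero    (suc k) = trans (ℚ.*-zeroʳ (fromℕ (suc k ℕ.!))) (sym (fallingFactorial-zero k))
k!*C≡fallingFactorial (suc x) zero    = refl
k!*C≡fallingFactorial (suc x) (suc k) = begin
  fromℕ (suc k ℕ.!) * fromℕ (suc x C suc k)
    ≡⟨ cong (fromℕ (suc k ℕ.!) *_) (fromℕ-pascal x k) ⟩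
  fromℕ (suc k ℕ.!) * (fromℕ (x C k) + fromℕ (x C suc k))
    ≡⟨ ℚ.*-distribˡ-+ (fromℕ (suc k ℕ.!)) (fromℕ (x C k)) (fromℕ (x C suc k)) ⟩
  fromℕ (suc k ℕ.* k ℕ.!) * fromℕ (x C k) + fromℕ (suc k ℕ.!) * fromℕ (x C suc k)
    ≡⟨ cong₂ _+_ (cong (_* fromℕ (x C k)) (fromℕ-* (suc k) (k ℕ.!))) (k!*C≡fallingFactorial x (suc k)) ⟩
  (fromℕ (suc k) * fromℕ (k ℕ.!)) * fromℕ (x C k) + F * (fromℕ x ℚ.- fromℕ k)
    ≡⟨ cong (_+ F * (fromℕ x ℚ.- fromℕ k)) (ℚ.*-assoc (fromℕ (suc k)) (fromℕ (k ℕ.!)) (fromℕ (x C k))) ⟩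
  fromℕ (suc k) * (fromℕ (k ℕ.!) * fromℕ (x C k)) + F * (fromℕ x ℚ.- fromℕ k)
    ≡⟨ cong (_+ F * (fromℕ x ℚ.- fromℕ k)) (cong₂ _*_ (fromℕ-+ 1 k) (k!*C≡fallingFactorial x k)) ⟩
  (1ℚ + fromℕ k) * F + F * (fromℕ x ℚ.- fromℕ k)
    ≡⟨ collect (fromℕ k) F (fromℕ x) ⟩
  (fromℕ x + 1ℚ) * F
    ≡⟨ fallingFactorial-suc-shift k (fromℕ x) ⟨
  fallingFactorial (suc k) (fromℕ x + 1ℚ)
    ≡⟨ cong (fallingFactorial (suc k)) (trans (fromℕ-+ 1 x) (ℚ.+-comm 1ℚ (fromℕ x))) ⟨
  fallingFactorial (suc k) (fromℕ (suc x)) ∎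
  where
  F = fallingFactorial k (fromℕ x)
  collect : ∀ k f x → (1ℚ + k) * f + f * (x ℚ.- k) ≡ (x + 1ℚ) * f
  collect = solve-∀ ℚ-ring

stirling1-vanishes : ∀ k i → k < i → stirling1 k i ≡ + 0
stirling1-vanishes zero    (suc i) _           = refl
stirling1-vanishes (suc k) (suc i) (ℕ.s≤s k<i)
  rewrite stirling1-vanishes k i k<i
        | stirling1-vanishes k (suc i) (ℕ.m<n⇒m<1+n k<i)
        | ℤ.*-zeroʳ (+ k) = refl

-- With P = Σᵢ s(k,i) xⁱ, the recurrence gives Σᵢ s(k+1,i) xⁱ = x P - k P, once P is split
-- as s(k,0) + (terms of positive degree) and the vanishing top term s(k,k+1) xᵏ⁺¹ is added.
stirling1-expansion : ∀ k x → ∑[ i < suc k ] (fromℤ (stirling1 k i) * x ^ i) ≡ fallingFactorial k x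
stirling1-expansion zero    x = refl
stirling1-expansion (suc k) x = begin
  s′ 0 * 1ℚ + ∑[ i < suc k ] (s′ (suc i) * (x * x ^ i))
    ≡⟨ cong₂ _+_ (cong (_* 1ℚ) s′0) (∑-cong (suc k) (λ i → cong (_* (x * x ^ i)) (s′-suc i))) ⟩
  - (K * s 0) * 1ℚ + ∑[ i < suc k ] ((s i ℚ.- K * s (suc i)) * (x * x ^ i))
    ≡⟨ cong (_+_ (- (K * s 0) * 1ℚ)) (∑-cong (suc k) (λ i → spread (s i) K (s (suc i)) x (x ^ i))) ⟩
  - (K * s 0) * 1ℚ + ∑[ i < suc k ] (x * (s i * x ^ i) + - K * (s (suc i) * x ^ suc i))
    ≡⟨ cong (_+_ (- (K * s 0) * 1ℚ)) (∑-distrib-+ (suc k) (λ i → x * P-term i) (λ i → - K * Q-term i)) ⟩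
  - (K * s 0) * 1ℚ + (∑[ i < suc k ] (x * (s i * x ^ i)) + ∑[ i < suc k ] (- K * (s (suc i) * x ^ suc i)))
    ≡⟨ cong (_+_ (- (K * s 0) * 1ℚ)) (cong₂ _+_ (*-distribˡ-∑ (suc k) x P-term) (*-distribˡ-∑ (suc k) (- K) Q-term)) ⟨
  - (K * s 0) * 1ℚ + (x * P + - K * Q)
    ≡⟨ cong (λ y → - (K * s 0) * 1ℚ + (x * y + - K * Q)) P≡s0+Q ⟩
  - (K * s 0) * 1ℚ + (x * (s 0 * 1ℚ + Q) + - K * Q)
    ≡⟨ collect (s 0) Q x K ⟩
  (s 0 * 1ℚ + Q) * (x ℚ.- K)
    ≡⟨ cong (_* (x ℚ.- K)) (trans (sym P≡s0+Q) (stirling1-expansion k x)) ⟩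
  fallingFactorial (suc k) x ∎
  where
  K = fromℕ k
  s s′ : ℕ → ℚ
  s  i = fromℤ (stirling1 k i)
  s′ i = fromℤ (stirling1 (suc k) i)
  P-term Q-term : ℕ → ℚ
  P-term i = s i * x ^ i
  Q-term i = s (suc i) * x ^ suc i
  P = ∑ (suc k) P-term
  Q = ∑ (suc k) Q-term
  s′0 : s′ 0 ≡ - (K * s 0)
  s′0 = trans (fromℤ-neg (+ k ℤ.* stirling1 k 0)) (cong -_ (fromℤ-* (+ k) (stirling1 k 0)))
  s′-suc : ∀ i → s′ (suc i) ≡ s i ℚ.- K * s (suc i)
  s′-suc i = begin
    fromℤ (stirling1 k i ℤ.+ ℤ.- ks)  ≡⟨ fromℤ-+ (stirling1 k i) (ℤ.- ks) ⟩
    s i + fromℤ (ℤ.- ks)              ≡⟨ cong (_+_ (s i)) (fromℤ-neg ks) ⟩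
    s i ℚ.- fromℤ ks                  ≡⟨ cong (ℚ._-_ (s i)) (fromℤ-* (+ k) (stirling1 k (suc i))) ⟩
    s i ℚ.- K * s (suc i)             ∎
    where ks = + k ℤ.* stirling1 k (suc i)
  P≡s0+Q : P ≡ s 0 * 1ℚ + Q
  P≡s0+Q = begin
    P                                    ≡⟨ ℚ.+-identityʳ P ⟨
    P + 0ℚ                               ≡⟨ cong (_+_ P) top-term≡0 ⟨
    P + P-term (suc k)                   ≡⟨ ∑-suc (suc k) P-term ⟨
    s 0 * 1ℚ + Q                         ∎
    where
    top-term≡0 : P-term (suc k) ≡ 0ℚ
    top-term≡0 = trans (cong (λ z → fromℤ z * x ^ suc k) (stirling1-vanishes k (suc k) (ℕ.n<1+n k)))
                       (ℚ.*-zeroˡ (x ^ suc k))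
  spread : ∀ a K b x y → (a ℚ.- K * b) * (x * y) ≡ x * (a * y) + - K * (b * (x * y))
  spread = solve-∀ ℚ-ring
  collect : ∀ a Q x K → - (K * a) * 1ℚ + (x * (a * 1ℚ + Q) + - K * Q) ≡ (a * 1ℚ + Q) * (x ℚ.- K)
  collect = solve-∀ ℚ-ring

negOnePow-*-^ : ∀ t x → negOnePow t * x ^ t ≡ (- x) ^ t
negOnePow-*-^ zero    x = ℚ.*-identityˡ 1ℚ
negOnePow-*-^ (suc t) x = begin
  - negOnePow t * (x * x ^ t)   ≡⟨ -a*[xb]≡-x*[ab] (negOnePow t) x (x ^ t) ⟩
  - x * (negOnePow t * x ^ t)   ≡⟨ cong (- x *_) (negOnePow-*-^ t x) ⟩
  - x * (- x) ^ t               ∎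
  where
  -a*[xb]≡-x*[ab] : ∀ a x b → - a * (x * b) ≡ - x * (a * b)
  -a*[xb]≡-x*[ab] = solve-∀ ℚ-ring

binomial-theorem : ∀ i x y → (x + y) ^ i ≡ ∑[ t < suc i ] (fromℕ (i C t) * (x ^ t * y ^ (i ∸ t)))
binomial-theorem i x y = trans (Binomial.theorem i x y) (∑-cong (suc i) (λ t → ×≡fromℕ* (i C t) (x ^ t * y ^ (i ∸ t))))

a6-summand : ℕ → ℕ → ℕ → ℕ → ℚ
a6-summand p n t i = fromℤ (stirling1 (suc p) i) * fromℤ (+ (i C t)) * negOnePow t * fromℤ (+ (suc n ℕ.^ (i ∸ t)))

factorial⁻¹ : ℕ → ℚ
factorial⁻¹ k = (+ 1 ℚ./ (k ℕ.!)) {{k ℕ.!≢0}}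

a6≡∑ : ∀ p n t → a6 p n t ≡ factorial⁻¹ (suc p) * ∑[ i < suc (suc p) ] a6-summand p n t i
a6≡∑ p n t = cong (factorial⁻¹ (suc p) *_) (sumFromTo≡∑ t (suc p) (a6-summand p n t) i<t⇒term≡0)
  where
  i<t⇒term≡0 : ∀ i → i < t → a6-summand p n t i ≡ 0ℚ
  i<t⇒term≡0 i i<t = begin
    a6-summand p n t i                ≡⟨ cong (λ c → σ * fromℕ c * negOnePow t * A) (k>n⇒nCk≡0 i<t) ⟩
    σ * 0ℚ * negOnePow t * A       ≡⟨ cong (λ x → x * negOnePow t * A) (ℚ.*-zeroʳ σ) ⟩
    0ℚ * negOnePow t * A           ≡⟨ cong (_* A) (ℚ.*-zeroˡ (negOnePow t)) ⟩
    0ℚ * A                         ≡⟨ ℚ.*-zeroˡ A ⟩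
    0ℚ                             ∎
    where
    σ = fromℤ (stirling1 (suc p) i)
    A = fromℕ (suc n ℕ.^ (i ∸ t))

a6-summand-*-^ : ∀ p n t i y →
  a6-summand p n t i * y ^ t ≡ fromℤ (stirling1 (suc p) i) * (fromℕ (i C t) * ((- y) ^ t * fromℕ (suc n) ^ (i ∸ t)))
a6-summand-*-^ p n t i y = begin
  σ * c * negOnePow t * fromℕ (suc n ℕ.^ (i ∸ t)) * y ^ t
    ≡⟨ cong (λ x → σ * c * negOnePow t * x * y ^ t) (fromℕ-^ (suc n) (i ∸ t)) ⟩
  σ * c * negOnePow t * A * y ^ t         ≡⟨ regroup σ c (negOnePow t) A (y ^ t) ⟩
  σ * (c * ((negOnePow t * y ^ t) * A))   ≡⟨ cong (λ x → σ * (c * (x * A))) (negOnePow-*-^ t y) ⟩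
  σ * (c * ((- y) ^ t * A))               ∎
  where
  σ = fromℤ (stirling1 (suc p) i)
  c = fromℕ (i C t)
  A = fromℕ (suc n) ^ (i ∸ t)
  regroup : ∀ σ c e A z → σ * c * e * A * z ≡ σ * (c * ((e * z) * A))
  regroup = solve-∀ ℚ-ring

∑-a6-summand-*-^ : ∀ p n i y → i < suc (suc p) →
  ∑[ t < suc (suc p) ] (a6-summand p n t i * y ^ t) ≡ fromℤ (stirling1 (suc p) i) * (- y + fromℕ (suc n)) ^ i
∑-a6-summand-*-^ p n i y i<p+2 = begin
  ∑[ t < suc (suc p) ] (a6-summand p n t i * y ^ t)   ≡⟨ ∑-cong (suc (suc p)) (λ t → a6-summand-*-^ p n t i y) ⟩
  ∑[ t < suc (suc p) ] (σ * term t)                   ≡⟨ *-distribˡ-∑ (suc (suc p)) σ term ⟨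
  σ * ∑ (suc (suc p)) term                            ≡⟨ cong (σ *_) (∑-extend term i<t⇒term≡0 i<p+2) ⟩
  σ * ∑ (suc i) term                                  ≡⟨ cong (σ *_) (binomial-theorem i (- y) (fromℕ (suc n))) ⟨
  σ * (- y + fromℕ (suc n)) ^ i                       ∎
  where
  σ = fromℤ (stirling1 (suc p) i)
  term : ℕ → ℚ
  term t = fromℕ (i C t) * ((- y) ^ t * fromℕ (suc n) ^ (i ∸ t))
  i<t⇒term≡0 : ∀ t → suc i ≤ t → term t ≡ 0ℚ
  i<t⇒term≡0 t i<t = trans (cong (λ c → fromℕ c * ((- y) ^ t * fromℕ (suc n) ^ (i ∸ t))) (k>n⇒nCk≡0 i<t))
                           (ℚ.*-zeroˡ ((- y) ^ t * fromℕ (suc n) ^ (i ∸ t)))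

binomial-as-a6-polynomial : ∀ p n j → j ≤ n → fromℕ ((n ∸ j) C suc p) ≡ ∑[ t < suc (suc p) ] (a6 p n t * fromℕ (suc j) ^ t)
binomial-as-a6-polynomial p n j j≤n = sym (begin
  ∑[ t < K ] (a6 p n t * B ^ t)
    ≡⟨ ∑-cong K (λ t → cong (_* B ^ t) (a6≡∑ p n t)) ⟩
  ∑[ t < K ] (c * ∑[ i < K ] a6-summand p n t i * B ^ t)
    ≡⟨ ∑-cong K (λ t → trans (ℚ.*-assoc c (∑ K (a6-summand p n t)) (B ^ t)) (cong (c *_) (*-distribʳ-∑ K (B ^ t) (a6-summand p n t)))) ⟩
  ∑[ t < K ] (c * ∑[ i < K ] (a6-summand p n t i * B ^ t))
    ≡⟨ *-distribˡ-∑ K c (λ t → ∑[ i < K ] (a6-summand p n t i * B ^ t)) ⟨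
  c * ∑[ t < K ] ∑[ i < K ] (a6-summand p n t i * B ^ t)
    ≡⟨ cong (c *_) (∑-comm K K (λ t i → a6-summand p n t i * B ^ t)) ⟩
  c * ∑[ i < K ] ∑[ t < K ] (a6-summand p n t i * B ^ t)
    ≡⟨ cong (c *_) (∑-cong< K (λ i i<K → ∑-a6-summand-*-^ p n i B i<K)) ⟩
  c * ∑[ i < K ] (fromℤ (stirling1 (suc p) i) * (- B + fromℕ (suc n)) ^ i)
    ≡⟨ cong (c *_) (stirling1-expansion (suc p) (- B + fromℕ (suc n))) ⟩
  c * fallingFactorial (suc p) (- B + fromℕ (suc n))
    ≡⟨ cong (λ x → c * fallingFactorial (suc p) x) n+1-[j+1] ⟩
  c * fallingFactorial (suc p) (fromℕ (n ∸ j))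
    ≡⟨ cong (c *_) (k!*C≡fallingFactorial (n ∸ j) (suc p)) ⟨
  c * (fromℕ (suc p ℕ.!) * binom)
    ≡⟨ ℚ.*-assoc c (fromℕ (suc p ℕ.!)) binom ⟨
  c * fromℕ (suc p ℕ.!) * binom
    ≡⟨ cong (_* binom) ([1/n]*n≡1 (suc p ℕ.!) {{suc p ℕ.!≢0}}) ⟩
  1ℚ * binom
    ≡⟨ ℚ.*-identityˡ binom ⟩
  binom ∎)
  where
  K = suc (suc p)
  B = fromℕ (suc j)
  c = factorial⁻¹ (suc p)
  binom = fromℕ ((n ∸ j) C suc p)
  n+1-[j+1] : - B + fromℕ (suc n) ≡ fromℕ (n ∸ j)
  n+1-[j+1] = trans (ℚ.+-comm (- B) (fromℕ (suc n))) (sym (fromℕ-∸ (ℕ.s≤s j≤n)))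

lemma8 : (r p n : ℕ) → 1 ≤ r → 1 ≤ p → 1 ≤ n →
    sumFromTo 1 n (λ k → fromℤ (+ (k C p)) * H (+ r) (n ∸ k))
      ≡ sumFromTo 0 (suc p) (λ t → a6 p n t * H ((+ r) - (+ t)) (n ∸ 1))
lemma8 r (suc p) (suc N) _ _ _ = begin
  sumFromTo 1 n (λ k → fromℕ (k C P) * H (+ r) (n ∸ k))
    ≡⟨ sumFromTo≡∑ 1 n (λ k → fromℕ (k C P) * H (+ r) (n ∸ k)) k<1⇒term≡0 ⟩
  ∑[ k < suc n ] (fromℕ (k C P) * H (+ r) (n ∸ k))
    ≡⟨ ∑-cong (suc n) (λ k → cong (fromℕ (k C P) *_) (H≡∑ (+ r) (n ∸ k))) ⟩
  ∑[ k < suc n ] (fromℕ (k C P) * ∑ (n ∸ k) w)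
    ≡⟨ ∑-C-*-∑ n P w ⟩
  ∑[ j < n ] (w j * fromℕ ((n ∸ j) C suc P))
    ≡⟨ drop-last-term ⟩
  ∑[ j < N ] (w j * fromℕ ((n ∸ j) C suc P))
    ≡⟨ ∑-cong< N (λ j j<N → cong (w j *_) (binomial-as-a6-polynomial P n j (ℕ.m≤n⇒m≤1+n (ℕ.<⇒≤ j<N)))) ⟩
  ∑[ j < N ] (w j * ∑[ t < K ] (a6 P n t * fromℕ (suc j) ^ t))
    ≡⟨ ∑-*-∑-swap N K w (a6 P n) (λ j t → fromℕ (suc j) ^ t) ⟩
  ∑[ t < K ] (a6 P n t * ∑[ j < N ] (w j * fromℕ (suc j) ^ t))
    ≡⟨ ∑-cong K (λ t → cong (a6 P n t *_) (trans (H≡∑ (+ r - + t) N) (∑-cong N (λ j → powNeg-∸ j (+ r) t)))) ⟨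
  ∑[ t < K ] (a6 P n t * H (+ r - + t) N)
    ≡⟨ sumFromTo≡∑ 0 (suc P) (λ t → a6 P n t * H (+ r - + t) N) (λ _ ()) ⟨
  sumFromTo 0 (suc P) (λ t → a6 P n t * H (+ r - + t) (n ∸ 1)) ∎
  where
  P = suc p
  n = suc N
  K = suc (suc P)
  w : ℕ → ℚ
  w j = powNeg j (+ r)
  k<1⇒term≡0 : ∀ k → k < 1 → fromℕ (k C P) * H (+ r) (n ∸ k) ≡ 0ℚ
  k<1⇒term≡0 zero    _            = ℚ.*-zeroˡ (H (+ r) n)
  k<1⇒term≡0 (suc _) (ℕ.s≤s ())
  summand : ℕ → ℚ
  summand j = w j * fromℕ ((n ∸ j) C suc P)
  drop-last-term : ∑ n summand ≡ ∑ N summand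
  drop-last-term = begin
    ∑ n summand                                        ≡⟨ ∑-suc N summand ⟩
    S + w N * fromℕ ((n ∸ N) C suc P)                  ≡⟨ cong (λ m → S + w N * fromℕ (m C suc P)) (ℕ.m+n∸n≡m 1 N) ⟩
    S + w N * 0ℚ                                       ≡⟨ cong (_+_ S) (ℚ.*-zeroʳ (w N)) ⟩
    S + 0ℚ                                             ≡⟨ ℚ.+-identityʳ S ⟩
    S                                                  ∎
    where S = ∑ N summand
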